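{- Let $T$ be a tree and $v$ a main core of $T$. Then every local set of $v$ has at least two vertices.
   Context: Let $T=(V,E)$ be a finite tree. A core is a vertex of degree at least $3$. For a vertex $v$, the subtrees of the neighbors of $v$ are the connected components of $T-v$. A (standard) leg of a core $v$ is a subtree of a neighbor of $v$ containing no core (a path attached to $v$); it is short if it has one vertex and long otherwise. For a leg $\ell$ of $v$, $\ell^i$ denotes the vertex of $\ell$ at distance $i$ from $v$ (its position is $i$). A small core is a core of degree exactly $3$ with at least two legs, at least one of which is short; other cores are regular. A modified leg of a core $v$ is a subtree of a neighbor of $v$ containing exactly one core, which is a small core $w$; the position of a vertex on it is its distance from $v$; if $w$ has position $i$, the two vertices of position $i+1$ are $\ell^a,\ell^b$, where $\ell^b$ is the vertex of a short leg of $w$ (chosen arbitrarily if both legs of $w$ inside $\ell$ are short). A g-leg of $v$ is a standard leg or a modified leg of $v$. A regular core $v$ is minor if either (i) $v$ has at most one g-leg, or (ii) $v$ has degree at least $4$, has no modified legs, has exactly two standard legs, at least one of which is short, and all other subtrees of neighbors of $v$ are not g-legs and contain regular cores. A regular core that is not minor is a main core. Solution types. For a set $S$ and a standard leg $\ell$, $S\cap\ell$ is of type $(s,0)$ if empty; $(s,1)$ if it is a single vertex of position at least $2$; $(s,2)$ if it has at least two vertices; $(s,3)$ if it equals $\{\ell^1\}$. For a modified leg $\ell$ whose small core has position $i$: type $(m,1)$ if $S\cap\ell$ equals $\{\ell^a\}$ or $\{\ell^b\}$; type $(m,2)$ if it contains neither $\ell^a$ nor $\ell^b$ and contains at least two vertices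 of position at least $i+2$; type $(m,3)$ if it has at least two vertices, at least one of which is $\ell^a$ or $\ell^b$. A local set of a core $v$ is a set $S$ of vertices of the g-legs of $v$ (so $v\notin S$) such that: (1) at most one standard leg has type $(s,0)$ and all other standard legs have type $(s,1)$, $(s,2)$ or $(s,3)$; (2) every modified leg has type $(m,1)$, $(m,2)$ or $(m,3)$; (3) if some standard leg has type $(s,0)$ then no modified leg has type $(m,1)$; (4) if some long leg $\ell$ has type $(s,0)$ then every long leg other than $\ell$ has type $(s,2)$; (5) if some short leg has type $(s,0)$ then every long leg has type $(s,2)$ or $(s,3)$. -}

module Defs where

open import Data.Nat using (ℕ; zero; suc; _≤_)
open import Data.Fin using (Fin)
open import Data.Fin.Subset using (Subset; _∈_; _∉_)
open import Data.Bool using (Bool; true; false)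
open import Data.List using (List; []; _∷_; [_]; _++_; length; filterᵇ; allFin)
open import Data.List.Relation.Unary.Unique.Propositional using (Unique)
open import Data.Product using (Σ; ∃; ∃₂; _×_; _,_)
open import Data.Sum using (_⊎_)
open import Relation.Nullary using (¬_)
open import Relation.Binary.PropositionalEquality using (_≡_; _≢_)

record Graph (n : ℕ) : Set where
  field
    adj        : Fin n → Fin n → Bool
    adj-sym    : ∀ x y → adj x y ≡ adj y x
    adj-irrefl : ∀ x → adj x x ≡ false

module _ {n : ℕ} (G : Graph n) where
  open Graph G

  Adj : Fin n → Fin n → Set
  Adj x y = adj x y ≡ true

  data WalkLen : Fin n → Fin n → ℕ → Set where
    nil  : ∀ x → WalkLen x x 0
    cons : ∀ {x y z k} → Adj x y → WalkLen y z k → WalkLen x z (suc k)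

  Connected : Set
  Connected = ∀ x y → ∃ λ k → WalkLen x y k

  data IsPath : List (Fin n) → Set where
    single : ∀ x → IsPath [ x ]
    cons   : ∀ {x y xs} → Adj x y → IsPath (y ∷ xs) → IsPath (x ∷ y ∷ xs)

  HasCycle : Set
  HasCycle = ∃₂ λ x ys → 2 ≤ length ys × Unique (x ∷ ys) × IsPath (x ∷ ys ++ [ x ])

  IsTree : Set
  IsTree = Connected × ¬ HasCycle

  deg : Fin n → ℕ
  deg v = length (filterᵇ (adj v) (allFin n))

  IsCore : Fin n → Set
  IsCore v = 3 ≤ deg v

  Dist : Fin n → Fin n → ℕ → Set
  Dist x y k = WalkLen x y k × (∀ m → WalkLen x y m → k ≤ m)

  data Avoid (v : Fin n) : Fin n → Fin n → Set where
    here : ∀ {x} → x ≢ v → Avoid v x x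
    step : ∀ {x y z} → x ≢ v → Adj x y → Avoid v y z → Avoid v x z

  -- for a neighbour u of v, InSub v u x : x lies in the subtree of u,
  -- i.e. the component of T - v containing u
  InSub : Fin n → Fin n → Fin n → Set
  InSub v u x = Avoid v u x

  IsStdLeg : Fin n → Fin n → Set
  IsStdLeg v u = Adj v u × (∀ x → InSub v u x → ¬ IsCore x)

  IsShortLeg : Fin n → Fin n → Set
  IsShortLeg v u = IsStdLeg v u × (∀ x → InSub v u x → x ≡ u)

  IsLongLeg : Fin n → Fin n → Set
  IsLongLeg v u = IsStdLeg v u × ¬ (∀ x → InSub v u x → x ≡ u)

  IsSmallCore : Fin n → Set
  IsSmallCore w = deg w ≡ 3 × ∃₂ λ u₁ u₂ → u₁ ≢ u₂ × IsStdLeg w u₁ × IsStdLeg w u₂ × IsShortLeg w u₁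

  IsRegularCore : Fin n → Set
  IsRegularCore w = IsCore w × ¬ IsSmallCore w

  IsModLeg : Fin n → Fin n → Set
  IsModLeg v u = Adj v u × ∃ λ w → InSub v u w × IsSmallCore w × (∀ x → InSub v u x → IsCore x → x ≡ w)

  IsGLeg : Fin n → Fin n → Set
  IsGLeg v u = IsStdLeg v u ⊎ IsModLeg v u

  -- x is the vertex ℓ^i of the leg ℓ (subtree of u): it lies in ℓ at distance i from v
  LegAt : Fin n → Fin n → ℕ → Fin n → Set
  LegAt v u i x = InSub v u x × Dist v x i

  IsMinorCore : Fin n → Set
  IsMinorCore v = IsRegularCore v ×
    ( (∀ u₁ u₂ → IsGLeg v u₁ → IsGLeg v u₂ → u₁ ≡ u₂)
    ⊎ (4 ≤ deg v × (∀ u → ¬ IsModLeg v u) ×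
       ∃₂ λ u₁ u₂ → u₁ ≢ u₂ × IsStdLeg v u₁ × IsStdLeg v u₂ ×
         (∀ u → IsStdLeg v u → u ≡ u₁ ⊎ u ≡ u₂) ×
         (IsShortLeg v u₁ ⊎ IsShortLeg v u₂) ×
         (∀ u → Adj v u → u ≢ u₁ → u ≢ u₂ →
            ¬ IsGLeg v u × ∃ λ x → InSub v u x × IsRegularCore x)))

  IsMainCore : Fin n → Set
  IsMainCore v = IsRegularCore v × ¬ IsMinorCore v

  module _ (S : Subset n) (v u : Fin n) where
    TypeS0 TypeS1 TypeS2 TypeS3 : Set
    TypeS0 = ∀ x → InSub v u x → x ∉ S
    TypeS1 = ∃ λ x → InSub v u x × x ∈ S × (∀ y → InSub v u y → y ∈ S → y ≡ x) ×
               ∃ λ i → Dist v x i × 2 ≤ i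
    TypeS2 = ∃₂ λ x y → x ≢ y × InSub v u x × x ∈ S × InSub v u y × y ∈ S
    TypeS3 = (∀ x → InSub v u x → x ∈ S → LegAt v u 1 x) × (∀ x → LegAt v u 1 x → x ∈ S)

    SmallCorePos : ℕ → Set
    SmallCorePos i = ∃ λ w → InSub v u w × IsSmallCore w × Dist v w i

    -- x is ℓ^a or ℓ^b: a vertex of the leg at position (position of small core) + 1
    IsAB : Fin n → Set
    IsAB x = ∃ λ i → SmallCorePos i × LegAt v u (suc i) x

    TypeM1 TypeM2 TypeM3 : Set
    TypeM1 = ∃ λ x → IsAB x × x ∈ S × (∀ y → InSub v u y → y ∈ S → y ≡ x)
    TypeM2 = ∃ λ i → SmallCorePos i × (∀ x → LegAt v u (suc i) x → x ∉ S) ×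
               ∃₂ λ x y → x ≢ y × InSub v u x × x ∈ S × InSub v u y × y ∈ S ×
                 (∃ λ j → Dist v x j × suc (suc i) ≤ j) × (∃ λ j → Dist v y j × suc (suc i) ≤ j)
    TypeM3 = (∃₂ λ x y → x ≢ y × InSub v u x × x ∈ S × InSub v u y × y ∈ S) ×
             (∃ λ z → IsAB z × z ∈ S)

  IsLocalSet : Subset n → Fin n → Set
  IsLocalSet S v =
      (∀ x → x ∈ S → ∃ λ u → IsGLeg v u × InSub v u x)
    × (∀ u₁ u₂ → IsStdLeg v u₁ → IsStdLeg v u₂ → TypeS0 S v u₁ → TypeS0 S v u₂ → u₁ ≡ u₂)
    × (∀ u → IsStdLeg v u → ¬ TypeS0 S v u → TypeS1 S v u ⊎ TypeS2 S v u ⊎ TypeS3 S v u)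
    × (∀ u → IsModLeg v u → TypeM1 S v u ⊎ TypeM2 S v u ⊎ TypeM3 S v u)
    × ((∃ λ u → IsStdLeg v u × TypeS0 S v u) → ∀ u′ → IsModLeg v u′ → ¬ TypeM1 S v u′)
    × (∀ u → IsLongLeg v u → TypeS0 S v u → ∀ u′ → IsLongLeg v u′ → u′ ≢ u → TypeS2 S v u′)
    × (∀ u → IsShortLeg v u → TypeS0 S v u → ∀ u′ → IsLongLeg v u′ → TypeS2 S v u′ ⊎ TypeS3 S v u′)

module Submission where

-- Suppose S is a local set of v with at most one vertex.  Every modified leg
-- meets S, so if S is empty all g-legs are standard legs of type (s,0), and
-- by condition (1) there is at most one: v is minor.  If S = {s}, let u₀ be
-- the g-leg containing s.  Since subtrees of distinct neighbours of v are
-- disjoint, every other g-leg is a standard leg of type (s,0).  If u₀ is a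
-- modified leg it has type (m,1) and condition (3) forbids further g-legs;
-- if u₀ is standard and there is a second g-leg u′, condition (4) forces one
-- of u₀, u′ to be short, and v satisfies clause (ii) of minority.  The one
-- geometric input for (ii) is that a subtree which is not a g-leg contains a
-- regular core: otherwise it would contain two small cores, and the branch
-- point of v and these two cores would be a core with two branches leading
-- to further cores, which no small core has.

open import Defs
open import Data.Nat using (ℕ; zero; suc; _≤_; z≤n; s≤s; _≤?_)
open import Data.Nat.Properties using (≤-trans; ≤-reflexive; ≤∧≢⇒<)
import Data.Nat.Properties as ℕ
open import Data.Fin using (Fin) renaming (zero to fzero; suc to fsuc)
open import Data.Fin.Properties using (_≟_)
open import Data.Fin.Subset using (Subset; ∣_∣; _∈_; _∉_)
open import Data.Fin.Subset.Properties using (x∈p⇒∣p-x∣<∣p∣; x∈p∧x≢y⇒x∈p-y)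
open import Data.Bool using (T)
open import Data.Bool.Properties using (T?)
open import Data.List using (List; []; _∷_; [_]; _++_; length)
open import Data.List.Relation.Unary.All using (All; []; _∷_)
import Data.List.Relation.Unary.All as All
open import Data.List.Relation.Unary.All.Properties using (++⁺; ¬Any⇒All¬)
open import Data.List.Relation.Unary.Any using (here; there)
open import Data.List.Relation.Unary.AllPairs using ([]; _∷_)
open import Data.List.Relation.Unary.Unique.Propositional using (Unique)
open import Data.List.Membership.Propositional using () renaming (_∈_ to _∈ₗ_)
open import Data.List.Membership.Propositional.Properties using (∈-filter⁺; ∈-allFin)
open import Data.Product using (∃; ∃₂; _×_; _,_; proj₁; proj₂)
open import Data.Sum using (_⊎_; inj₁; inj₂)
open import Data.Unit using (tt)
open import Data.Empty using (⊥; ⊥-elim)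
open import Relation.Nullary using (¬_; yes; no)
open import Relation.Binary.PropositionalEquality using (_≡_; _≢_; refl; sym; trans; subst; cong)
open import Function using (_∘_)

-- Minority is only obtained under ¬¬, because "the subtree contains a
-- regular core" is established by contradiction; the final goal ⊥ absorbs
-- the double negations.

¬¬-→ : {A B : Set} → (A → ¬ ¬ B) → ¬ ¬ (A → B)
¬¬-→ f k = k (λ a → ⊥-elim (f a (λ b → k (λ _ → b))))

¬¬-∀Fin : ∀ {m} {P : Fin m → Set} → (∀ i → ¬ ¬ P i) → ¬ ¬ (∀ i → P i)
¬¬-∀Fin {zero}      h k = k (λ ())
¬¬-∀Fin {suc m} {P} h k =
  h fzero (λ p₀ → ¬¬-∀Fin {m} {P ∘ fsuc} (h ∘ fsuc)
                    (λ ps → k (λ { fzero → p₀ ; (fsuc i) → ps i })))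

twoMembers : ∀ {m} {S : Subset m} {x y} → x ∈ S → y ∈ S → x ≢ y → 2 ≤ ∣ S ∣
twoMembers x∈S y∈S x≢y =
  ≤-trans (s≤s (s≤s z≤n))
    (≤-trans (s≤s (x∈p⇒∣p-x∣<∣p∣ (x∈p∧x≢y⇒x∈p-y y∈S (x≢y ∘ sym)))) (x∈p⇒∣p-x∣<∣p∣ x∈S))

fewerThanTwo⇒atMostOne : ∀ {m} {S : Subset m} → ¬ (2 ≤ ∣ S ∣) → ∀ {x y} → x ∈ S → y ∈ S → x ≡ y
fewerThanTwo⇒atMostOne ¬2≤∣S∣ {x} {y} x∈S y∈S with x ≟ y
... | yes x≡y = x≡y
... | no x≢y  = ⊥-elim (¬2≤∣S∣ (twoMembers x∈S y∈S x≢y))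

remove : ∀ {A : Set} {x : A} (M : List A) → x ∈ₗ M → List A
remove (_ ∷ M) (here _)    = M
remove (y ∷ M) (there x∈M) = y ∷ remove M x∈M

length-remove : ∀ {A : Set} {x : A} (M : List A) (x∈M : x ∈ₗ M) → length M ≡ suc (length (remove M x∈M))
length-remove (_ ∷ M) (here _)    = refl
length-remove (y ∷ M) (there x∈M) = cong suc (length-remove M x∈M)

∈-remove : ∀ {A : Set} {x y : A} (M : List A) (x∈M : x ∈ₗ M) → y ∈ₗ M → x ≢ y → y ∈ₗ remove M x∈M
∈-remove (_ ∷ M) (here refl)  (here refl)  x≢y = ⊥-elim (x≢y refl)
∈-remove (_ ∷ M) (here refl)  (there y∈M)  _   = y∈M
∈-remove (_ ∷ M) (there _)    (here y≡z)   _   = here y≡z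
∈-remove (_ ∷ M) (there x∈M)  (there y∈M)  x≢y = there (∈-remove M x∈M y∈M x≢y)

unique-length≤ : ∀ {A : Set} {L M : List A} → Unique L → (∀ {x} → x ∈ₗ L → x ∈ₗ M) → length L ≤ length M
unique-length≤ []                  _   = z≤n
unique-length≤ {M = M} (x∉L ∷ uL) L⊆M =
  ≤-trans (s≤s (unique-length≤ uL (λ y∈L → ∈-remove M x∈M (L⊆M (there y∈L)) (All.lookup x∉L y∈L))))
          (≤-reflexive (sym (length-remove M x∈M)))
  where x∈M = L⊆M (here refl)

module _ {n : ℕ} (G : Graph n) where
  open Graph G using (adj; adj-sym)
  open import Data.List.Membership.DecPropositional (_≟_ {n = n}) using (_∈?_)

  Adj-sym : ∀ {x y} → Adj G x y → Adj G y x
  Adj-sym {x} {y} x~y = trans (adj-sym y x) x~y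

  neighbours≤deg : ∀ {m L} → Unique L → All (Adj G m) L → length L ≤ deg G m
  neighbours≤deg {m} uL m~L =
    unique-length≤ uL (λ {x} x∈L → ∈-filter⁺ (T? ∘ adj m) (∈-allFin x) (subst T (sym (All.lookup m~L x∈L)) tt))

  threeNeighbours⇒core : ∀ {m x y z} → Adj G m x → Adj G m y → Adj G m z →
                         x ≢ y → x ≢ z → y ≢ z → IsCore G m
  threeNeighbours⇒core m~x m~y m~z x≢y x≢z y≢z =
    neighbours≤deg ((x≢y ∷ x≢z ∷ []) ∷ (y≢z ∷ []) ∷ [] ∷ []) (m~x ∷ m~y ∷ m~z ∷ [])

  -- Walks, indexed by their list of vertices; confinement of a walk to a
  -- region P is expressed separately as All P of that list.
  data Walk : Fin n → Fin n → List (Fin n) → Set where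
    wnil  : ∀ x → Walk x x [ x ]
    wcons : ∀ {x y z L} → Adj G x y → Walk y z L → Walk x z (x ∷ L)

  walk-head : ∀ {P : Fin n → Set} {x y L} → Walk x y L → All P L → P x
  walk-head (wnil _)    (px ∷ _) = px
  walk-head (wcons _ _) (px ∷ _) = px

  walk-snoc : ∀ {x y z L} → Walk x y L → Adj G y z → Walk x z (L ++ [ z ])
  walk-snoc (wnil _)      y~z = wcons y~z (wnil _)
  walk-snoc (wcons x~w W) y~z = wcons x~w (walk-snoc W y~z)

  avoid⇒walk : ∀ {v x y} → Avoid G v x y → ∃ λ L → Walk x y L × All (v ≢_) L
  avoid⇒walk {x = x} (here x≢v) = [ x ] , wnil x , (x≢v ∘ sym) ∷ []
  avoid⇒walk {x = x} (step x≢v x~y A) =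
    let (L , W , W∌v) = avoid⇒walk A in x ∷ L , wcons x~y W , (x≢v ∘ sym) ∷ W∌v

  walk⇒avoid : ∀ {v x y L} → Walk x y L → All (v ≢_) L → Avoid G v x y
  walk⇒avoid (wnil _)      (v≢x ∷ [])  = here (v≢x ∘ sym)
  walk⇒avoid (wcons x~y W) (v≢x ∷ W∌v) = step (v≢x ∘ sym) x~y (walk⇒avoid W W∌v)

  avoid-snoc : ∀ {v x y z} → Avoid G v x y → Adj G y z → z ≢ v → Avoid G v x z
  avoid-snoc (here x≢v)       y~z z≢v = step x≢v y~z (here z≢v)
  avoid-snoc (step x≢v x~w A) y~z z≢v = step x≢v x~w (avoid-snoc A y~z z≢v)

  module _ {P : Fin n → Set} where

    walk-reverse : ∀ {x y L} → Walk x y L → All P L → ∃ λ L′ → Walk y x L′ × All P L′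
    walk-reverse (wnil x) pL = _ , wnil x , pL
    walk-reverse {x = x} (wcons x~y W) (px ∷ pW) =
      let (L′ , W′ , pW′) = walk-reverse W pW
      in L′ ++ [ x ] , walk-snoc W′ (Adj-sym x~y) , ++⁺ pW′ (px ∷ [])

    walk-append : ∀ {x y z L M} → Walk x y L → Walk y z M → All P L → All P M →
                  ∃ λ K → Walk x z K × All P K
    walk-append (wnil _)      V _         pV = _ , V , pV
    walk-append (wcons x~w W) V (px ∷ pW) pV =
      let (K , WV , pWV) = walk-append W V pW pV in _ , wcons x~w WV , px ∷ pWV

    walk-suffix : ∀ {x y z L} → Walk y z L → Unique L → All P L → x ∈ₗ L →
                  ∃ λ B → Walk x z B × Unique B × All P B
    walk-suffix W@(wnil _)    uL pL (here refl) = _ , W , uL , pL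
    walk-suffix W@(wcons _ _) uL pL (here refl) = _ , W , uL , pL
    walk-suffix (wcons _ W) (_ ∷ uW) (_ ∷ pW) (there x∈W) = walk-suffix W uW pW x∈W

    loop-erase : ∀ {x y L} → Walk x y L → All P L → ∃ λ L′ → Walk x y L′ × Unique L′ × All P L′
    loop-erase (wnil x) pL = _ , wnil x , [] ∷ [] , pL
    loop-erase {x = x} (wcons x~y W) (px ∷ pW) with loop-erase W pW
    ... | L′ , W′ , uW′ , pW′ with x ∈? L′
    ...   | yes x∈L′ = walk-suffix W′ uW′ pW′ x∈L′
    ...   | no  x∉L′ = x ∷ L′ , wcons x~y W′ , ¬Any⇒All¬ L′ x∉L′ ∷ uW′ , px ∷ pW′

  walk-length≥2 : ∀ {x y L} → Walk x y L → x ≢ y → 2 ≤ length L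
  walk-length≥2 (wnil _)              x≢x = ⊥-elim (x≢x refl)
  walk-length≥2 (wcons _ (wnil _))    _   = s≤s (s≤s z≤n)
  walk-length≥2 (wcons _ (wcons _ _)) _   = s≤s (s≤s z≤n)

  closed-path : ∀ {z x y z′ L} → Adj G z x → Walk x y L → Adj G y z′ → IsPath G (z ∷ L ++ [ z′ ])
  closed-path z~x (wnil _)      y~z′ = cons z~x (cons y~z′ (single _))
  closed-path z~x (wcons x~w W) y~z′ = cons z~x (closed-path x~w W y~z′)

  -- In an acyclic graph the subtrees of distinct neighbours u₁, u₂ of v are
  -- disjoint: a common vertex would give a simple walk u₁ ⋯ u₂ avoiding v,
  -- closing a cycle through v.
  subtrees-disjoint : ¬ HasCycle G → ∀ {v u₁ u₂ x} → Adj G v u₁ → Adj G v u₂ → u₁ ≢ u₂ →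
                      InSub G v u₁ x → InSub G v u₂ x → ⊥
  subtrees-disjoint acyclic {v} v~u₁ v~u₂ u₁≢u₂ x∈u₁ x∈u₂ =
    let (_ , W₁ , W₁∌v) = avoid⇒walk x∈u₁
        (_ , W₂ , W₂∌v) = avoid⇒walk x∈u₂
        (_ , W₂′ , W₂′∌v) = walk-reverse W₂ W₂∌v
        (_ , W , W∌v) = walk-append W₁ W₂′ W₁∌v W₂′∌v
        (C , path , uC , C∌v) = loop-erase W W∌v
    in acyclic (v , C , walk-length≥2 path u₁≢u₂ , C∌v ∷ uC , closed-path v~u₁ path (Adj-sym v~u₂))

  smallCore⇒core : ∀ {w} → IsSmallCore G w → IsCore G w
  smallCore⇒core (deg≡3 , _) = ≤-reflexive (sym deg≡3)

  LeadsToCore : Fin n → Fin n → Set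
  LeadsToCore m q = ∃ λ x → IsCore G x × Avoid G m q x

  TwoCoreBranches : Fin n → Set
  TwoCoreBranches m = ∃₂ λ q r → q ≢ r × Adj G m q × Adj G m r × LeadsToCore m q × LeadsToCore m r

  -- A small core has at most one branch leading to a core: its two legs
  -- contain no core, so two such branches would give it four neighbours.
  smallCore-oneBranch : ∀ {m} → IsSmallCore G m → ¬ TwoCoreBranches m
  smallCore-oneBranch {m} (deg≡3 , a , b , a≢b , (m~a , legA) , (m~b , legB) , _)
                          (q , r , q≢r , m~q , m~r , q→core , r→core) =
    4≰3 (subst (4 ≤_) deg≡3 (neighbours≤deg distinct (m~a ∷ m~b ∷ m~q ∷ m~r ∷ [])))
    where
    legNotBranch : ∀ {a y} → (∀ x → Avoid G m a x → ¬ IsCore G x) → LeadsToCore m y → a ≢ y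
    legNotBranch leg (x , coreX , a→x) refl = leg x a→x coreX
    distinct : Unique (a ∷ b ∷ q ∷ r ∷ [])
    distinct = (a≢b ∷ legNotBranch legA q→core ∷ legNotBranch legA r→core ∷ [])
             ∷ (legNotBranch legB q→core ∷ legNotBranch legB r→core ∷ [])
             ∷ (q≢r ∷ []) ∷ [] ∷ []
    4≰3 : ¬ (4 ≤ 3)
    4≰3 (s≤s (s≤s (s≤s ())))

  -- Follow simple walks Q from a to v and R from a to
  -- b (R avoiding v) along their common prefix; where they split, or where R
  -- ends, we stand at a core with two branches leading to cores.
  module BranchPoint {v u a b : Fin n} (coreV : IsCore G v) (coreA : IsCore G a) (coreB : IsCore G b) where

    Found : Set
    Found = ∃ λ m → InSub G v u m × IsCore G m × TwoCoreBranches m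

    -- At an inner vertex m of the common prefix, entered from p: the rest of
    -- Q and R avoid p, and from p one reaches a while avoiding any later
    -- vertex of Q.
    inner : ∀ {p m Lq Lr} → Adj G m p → Walk m v Lq → Unique (p ∷ Lq) → Walk m b Lr → Unique (p ∷ Lr) →
            All (v ≢_) Lr → All (λ w → Avoid G w p a) Lq → InSub G v u m → Found
    inner _ (wnil _) _ R _ R∌v _ _ = ⊥-elim (walk-head R R∌v refl)
    inner {p} {m} m~p (wcons {y = q} m~q Q) ((_ ∷ Q∌p) ∷ (Q∌m ∷ _)) (wnil _) _ _ (p→a ∷ _) m∈u =
      m , m∈u , coreB , p , q , walk-head Q Q∌p , m~p , m~q , (a , coreA , p→a) , (v , coreV , walk⇒avoid Q Q∌m)
    inner {p} {m} m~p (wcons {y = q} m~q Q) ((_ ∷ Q∌p) ∷ (Q∌m ∷ uQ)) (wcons {y = r} m~r R)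
          ((_ ∷ R∌p) ∷ (R∌m ∷ uR)) (_ ∷ R∌v) (_ ∷ back) m∈u with q ≟ r
    ... | no q≢r =
      m , m∈u , threeNeighbours⇒core m~p m~q m~r (walk-head Q Q∌p) (walk-head R R∌p) q≢r ,
      q , r , q≢r , m~q , m~r , (v , coreV , walk⇒avoid Q Q∌m) , (b , coreB , walk⇒avoid R R∌m)
    ... | yes refl =
      inner (Adj-sym m~q) Q (Q∌m ∷ uQ) R (R∌m ∷ uR) R∌v
            (All.zipWith (λ (m≢w , p→a) → step m≢w m~p p→a) (Q∌m , back))
            (avoid-snoc m∈u m~r (walk-head R R∌v ∘ sym))

    start : ∀ {Lq Lr} → Walk a v Lq → Unique Lq → Walk a b Lr → Unique Lr → All (v ≢_) Lr →
            b ≢ a → InSub G v u a → Found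
    start (wnil _)    _ R        _ R∌v _   _ = ⊥-elim (walk-head R R∌v refl)
    start (wcons _ _) _ (wnil _) _ _   b≢a _ = ⊥-elim (b≢a refl)
    start (wcons {y = q} a~q Q) (Q∌a ∷ uQ) (wcons {y = r} a~r R) (R∌a ∷ uR) (_ ∷ R∌v) _ a∈u with q ≟ r
    ... | no q≢r =
      a , a∈u , coreA , q , r , q≢r , a~q , a~r , (v , coreV , walk⇒avoid Q Q∌a) , (b , coreB , walk⇒avoid R R∌a)
    ... | yes refl =
      inner (Adj-sym a~q) Q (Q∌a ∷ uQ) R (R∌a ∷ uR) R∌v (All.map here Q∌a)
            (avoid-snoc a∈u a~r (walk-head R R∌v ∘ sym))

  -- If the subtree of a neighbour u of the core v contains two distinct
  -- cores, it contains a regular core (their branch point with v).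
  twoCores⇒regularCore : ∀ {v u a b} → IsCore G v → Adj G v u →
                         InSub G v u a → IsCore G a → InSub G v u b → IsCore G b → b ≢ a →
                         ∃ λ m → InSub G v u m × IsRegularCore G m
  twoCores⇒regularCore coreV v~u a∈u coreA b∈u coreB b≢a =
    let (_ , Wua , Wua∌v) = avoid⇒walk a∈u
        (_ , Wau , Wau∌v) = walk-reverse Wua Wua∌v
        (_ , Q , uQ , _) = loop-erase (walk-snoc Wau (Adj-sym v~u)) (All.universal (λ _ → tt) _)
        (_ , Wub , Wub∌v) = avoid⇒walk b∈u
        (_ , Wab , Wab∌v) = walk-append Wau Wub Wau∌v Wub∌v
        (_ , R , uR , R∌v) = loop-erase Wab Wab∌v
        (m , m∈u , coreM , branches) = BranchPoint.start coreV coreA coreB Q uQ R uR R∌v b≢a a∈u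
    in m , m∈u , coreM , (λ small → smallCore-oneBranch small branches)

  -- Otherwise every core c of the subtree is small and, by
  -- the previous lemma, its only core, so the subtree would be a modified
  -- leg; hence it has no core and would be a standard leg.
  nonGLeg⇒regularCore : ∀ {v u} → IsCore G v → Adj G v u → ¬ IsGLeg G v u →
                        ¬ ¬ (∃ λ x → InSub G v u x × IsRegularCore G x)
  nonGLeg⇒regularCore {v} {u} coreV v~u ¬gLeg ¬regular = ¬gLeg (inj₁ (v~u , noCore))
    where
    noCore : ∀ c → InSub G v u c → ¬ IsCore G c
    noCore c c∈u coreC = ¬regular (c , c∈u , coreC , λ small → ¬gLeg (inj₂ (v~u , c , c∈u , small , onlyCore)))
      where
      onlyCore : ∀ x → InSub G v u x → IsCore G x → x ≡ c
      onlyCore x x∈u coreX with x ≟ c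
      ... | yes x≡c = x≡c
      ... | no  x≢c = ⊥-elim (¬regular (twoCores⇒regularCore coreV v~u c∈u coreC x∈u coreX x≢c))

  -- A standard leg contains no core, a modified leg does.
  stdLeg-not-modLeg : ∀ {v u} → IsStdLeg G v u → ¬ IsModLeg G v u
  stdLeg-not-modLeg (_ , noCore) (_ , w , w∈u , smallW , _) = noCore w w∈u (smallCore⇒core smallW)

  gLeg-adj : ∀ {v u} → IsGLeg G v u → Adj G v u
  gLeg-adj (inj₁ (v~u , _)) = v~u
  gLeg-adj (inj₂ (v~u , _)) = v~u

  -- A regular core with two standard legs, one of them short, is not of
  -- degree 3 (it would be small), so it has degree at least 4.
  twoLegs⇒deg≥4 : ∀ {v u₁ u₂} → IsRegularCore G v → u₁ ≢ u₂ → IsStdLeg G v u₁ → IsStdLeg G v u₂ →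
                  IsShortLeg G v u₁ ⊎ IsShortLeg G v u₂ → 4 ≤ deg G v
  twoLegs⇒deg≥4 {v} {u₁} {u₂} (coreV , ¬small) u₁≢u₂ leg₁ leg₂ short with deg G v ℕ.≟ 3
  ... | no  deg≢3 = ≤∧≢⇒< coreV (deg≢3 ∘ sym)
  ... | yes deg≡3 with short
  ...   | inj₁ short₁ = ⊥-elim (¬small (deg≡3 , u₁ , u₂ , u₁≢u₂ , leg₁ , leg₂ , short₁))
  ...   | inj₂ short₂ = ⊥-elim (¬small (deg≡3 , u₂ , u₁ , u₁≢u₂ ∘ sym , leg₂ , leg₁ , short₂))

  module SmallLocalSet (acyclic : ¬ HasCycle G) {v : Fin n} (regular : IsRegularCore G v)
                       {S : Subset n} (local : IsLocalSet G S v) where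

    inGLeg : ∀ x → x ∈ S → ∃ λ u → IsGLeg G v u × InSub G v u x
    inGLeg = proj₁ local

    oneEmptyLeg : ∀ u₁ u₂ → IsStdLeg G v u₁ → IsStdLeg G v u₂ → TypeS0 G S v u₁ → TypeS0 G S v u₂ → u₁ ≡ u₂
    oneEmptyLeg = proj₁ (proj₂ local)

    modLegTypes : ∀ u → IsModLeg G v u → TypeM1 G S v u ⊎ TypeM2 G S v u ⊎ TypeM3 G S v u
    modLegTypes = proj₁ (proj₂ (proj₂ (proj₂ local)))

    emptyLeg⇒noM1 : (∃ λ u → IsStdLeg G v u × TypeS0 G S v u) → ∀ u → IsModLeg G v u → ¬ TypeM1 G S v u
    emptyLeg⇒noM1 = proj₁ (proj₂ (proj₂ (proj₂ (proj₂ local))))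

    emptyLongLeg⇒S2 : ∀ u → IsLongLeg G v u → TypeS0 G S v u → ∀ u′ → IsLongLeg G v u′ → u′ ≢ u → TypeS2 G S v u′
    emptyLongLeg⇒S2 = proj₁ (proj₂ (proj₂ (proj₂ (proj₂ (proj₂ local)))))

    modLeg-meets-S : ∀ {u} → IsModLeg G v u → ∃ λ x → InSub G v u x × x ∈ S
    modLeg-meets-S {u} mod with modLegTypes u mod
    ... | inj₁ (x , (_ , _ , x∈u , _) , x∈S , _)                = x , x∈u , x∈S
    ... | inj₂ (inj₁ (_ , _ , _ , x , _ , _ , x∈u , x∈S , _))   = x , x∈u , x∈S
    ... | inj₂ (inj₂ ((x , _ , _ , x∈u , x∈S , _) , _))         = x , x∈u , x∈S

    onlyGLeg⇒minor : ∀ {u₀} → (∀ u → IsGLeg G v u → u ≢ u₀ → ⊥) → IsMinorCore G v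
    onlyGLeg⇒minor {u₀} noOther = regular , inj₁ (λ u₁ u₂ g₁ g₂ → trans (is-u₀ u₁ g₁) (sym (is-u₀ u₂ g₂)))
      where
      is-u₀ : ∀ u → IsGLeg G v u → u ≡ u₀
      is-u₀ u g with u ≟ u₀
      ... | yes u≡u₀ = u≡u₀
      ... | no  u≢u₀ = ⊥-elim (noOther u g u≢u₀)

    -- S = ∅: every g-leg is a standard leg of type (s,0), so there is at most one.
    empty⇒minor : (∀ x → x ∉ S) → IsMinorCore G v
    empty⇒minor empty = regular , inj₁ (λ u₁ u₂ g₁ g₂ → oneEmptyLeg u₁ u₂ (std g₁) (std g₂) (λ x _ → empty x) (λ x _ → empty x))
      where
      std : ∀ {u} → IsGLeg G v u → IsStdLeg G v u
      std (inj₁ leg) = leg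
      std (inj₂ mod) = let (x , _ , x∈S) = modLeg-meets-S mod in ⊥-elim (empty x x∈S)

    module Singleton (s : Fin n) (s∈S : s ∈ S) (only : ∀ y → y ∈ S → y ≡ s) where

      u₀ : Fin n
      u₀ = proj₁ (inGLeg s s∈S)

      gLeg₀ : IsGLeg G v u₀
      gLeg₀ = proj₁ (proj₂ (inGLeg s s∈S))

      noTwoMembers : ∀ {x y} → x ≢ y → x ∈ S → y ∈ S → ⊥
      noTwoMembers x≢y x∈S y∈S = x≢y (trans (only _ x∈S) (sym (only _ y∈S)))

      emptyElsewhere : ∀ {u} → Adj G v u → u ≢ u₀ → TypeS0 G S v u
      emptyElsewhere {u} v~u u≢u₀ x x∈u x∈S =
        subtrees-disjoint acyclic v~u (gLeg-adj gLeg₀) u≢u₀ (subst (InSub G v u) (only x x∈S) x∈u)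
                          (proj₂ (proj₂ (inGLeg s s∈S)))

      otherGLeg : ∀ {u} → IsGLeg G v u → u ≢ u₀ → IsStdLeg G v u × TypeS0 G S v u
      otherGLeg (inj₁ leg) u≢u₀ = leg , emptyElsewhere (proj₁ leg) u≢u₀
      otherGLeg (inj₂ mod) u≢u₀ =
        let (x , x∈u , x∈S) = modLeg-meets-S mod in ⊥-elim (emptyElsewhere (proj₁ mod) u≢u₀ x x∈u x∈S)

      -- A modified leg u₀ has type (m,1), so by condition (3) it is the only g-leg.
      modCase : IsModLeg G v u₀ → IsMinorCore G v
      modCase mod₀ = onlyGLeg⇒minor (λ u g u≢u₀ → emptyLeg⇒noM1 (u , otherGLeg g u≢u₀) u₀ mod₀ typeM1)
        where
        typeM1 : TypeM1 G S v u₀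
        typeM1 with modLegTypes u₀ mod₀
        ... | inj₁ m1 = m1
        ... | inj₂ (inj₁ (_ , _ , _ , _ , _ , x≢y , _ , x∈S , _ , y∈S , _)) = ⊥-elim (noTwoMembers x≢y x∈S y∈S)
        ... | inj₂ (inj₂ ((_ , _ , x≢y , _ , x∈S , _ , y∈S) , _))         = ⊥-elim (noTwoMembers x≢y x∈S y∈S)

      pairCase : IsStdLeg G v u₀ → ∀ {u′} → IsGLeg G v u′ → u′ ≢ u₀ → ¬ ¬ IsMinorCore G v
      pairCase leg₀ {u′} g′ u′≢u₀ ¬minor =
        oneShort (λ short → ¬¬-∀Fin outerNeighbour (λ outer →
          ¬minor (regular , inj₂ ( twoLegs⇒deg≥4 regular (u′≢u₀ ∘ sym) leg₀ leg′ short , noModLeg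
                                 , u₀ , u′ , u′≢u₀ ∘ sym , leg₀ , leg′ , (λ u leg → twoGLegs u (inj₁ leg))
                                 , short , outer))))
        where
        leg′ : IsStdLeg G v u′
        leg′ = proj₁ (otherGLeg g′ u′≢u₀)

        empty′ : TypeS0 G S v u′
        empty′ = proj₂ (otherGLeg g′ u′≢u₀)

        twoGLegs : ∀ u → IsGLeg G v u → u ≡ u₀ ⊎ u ≡ u′
        twoGLegs u g with u ≟ u₀
        ... | yes u≡u₀ = inj₁ u≡u₀
        ... | no  u≢u₀ = inj₂ (oneEmptyLeg u u′ (proj₁ (otherGLeg g u≢u₀)) leg′ (proj₂ (otherGLeg g u≢u₀)) empty′)

        -- Condition (4): were both legs long, u₀ would have type (s,2).
        oneShort : ¬ ¬ (IsShortLeg G v u₀ ⊎ IsShortLeg G v u′)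
        oneShort ¬short =
          let (x , y , x≢y , _ , x∈S , _ , y∈S) =
                emptyLongLeg⇒S2 u′ (leg′ , λ h → ¬short (inj₂ (leg′ , h))) empty′
                                u₀ (leg₀ , λ h → ¬short (inj₁ (leg₀ , h))) (u′≢u₀ ∘ sym)
          in noTwoMembers x≢y x∈S y∈S

        noModLeg : ∀ u → ¬ IsModLeg G v u
        noModLeg u mod with u ≟ u₀
        ... | yes refl = stdLeg-not-modLeg leg₀ mod
        ... | no  u≢u₀ = stdLeg-not-modLeg (proj₁ (otherGLeg (inj₂ mod) u≢u₀)) mod

        outerNeighbour : ∀ u → ¬ ¬ (Adj G v u → u ≢ u₀ → u ≢ u′ →
                                    ¬ IsGLeg G v u × ∃ λ x → InSub G v u x × IsRegularCore G x)
        outerNeighbour u = ¬¬-→ λ v~u → ¬¬-→ λ u≢u₀ → ¬¬-→ λ u≢u′ k →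
          nonGLeg⇒regularCore (proj₁ regular) v~u (notGLeg u≢u₀ u≢u′) (λ core → k (notGLeg u≢u₀ u≢u′ , core))
          where
          notGLeg : u ≢ u₀ → u ≢ u′ → ¬ IsGLeg G v u
          notGLeg u≢u₀ u≢u′ g with twoGLegs u g
          ... | inj₁ u≡u₀ = u≢u₀ u≡u₀
          ... | inj₂ u≡u′ = u≢u′ u≡u′

      singleton⇒¬¬minor : ¬ ¬ IsMinorCore G v
      singleton⇒¬¬minor ¬minor with gLeg₀
      ... | inj₂ mod₀ = ¬minor (modCase mod₀)
      ... | inj₁ leg₀ = ¬minor (onlyGLeg⇒minor (λ u g u≢u₀ → pairCase leg₀ g u≢u₀ ¬minor))

    atMostOne⇒¬¬minor : (∀ {x y} → x ∈ S → y ∈ S → x ≡ y) → ¬ ¬ IsMinorCore G v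
    atMostOne⇒¬¬minor atMostOne ¬minor =
      ¬minor (empty⇒minor (λ s s∈S →
        Singleton.singleton⇒¬¬minor s s∈S (λ y y∈S → atMostOne y∈S s∈S) ¬minor))

lemma4 : ∀ {n : ℕ} (G : Graph n) → IsTree G → (v : Fin n) → IsMainCore G v →
           (S : Subset n) → IsLocalSet G S v → 2 ≤ ∣ S ∣
lemma4 G (_ , acyclic) v (regular , ¬minor) S local with 2 ≤? ∣ S ∣
... | yes 2≤∣S∣ = 2≤∣S∣
... | no  ¬2≤∣S∣ =
  ⊥-elim (SmallLocalSet.atMostOne⇒¬¬minor G acyclic regular local (fewerThanTwo⇒atMostOne ¬2≤∣S∣) ¬minor)
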